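{- Let $n \ge 2$ be an integer and let $G = G_{2^n+1,2}$. Then $\chi(G[W]) = \chi(G) = n+1$, where \[ W = \{(x,y) : 1 \le x < y \le 2^n+1 \text{ and } \{x,y\} \subseteq I_\ell \text{ for some } \ell \in \{0,1,\dots,n\}\}, \] and $I_\ell = [\,2^\ell,\; 2^n - 2^{n-\ell} + 2\,]$ for $0 \le \ell \le n$.
   Context: For integers $p \le q$, $[p,q]$ denotes $\{p,p+1,\dots,q\}$. For an integer $N \ge 5$, the shift graph $G_{N,2}$ has as vertices the ordered pairs $(x,y)$ of integers with $1 \le x < y \le N$, and two vertices $(x,y)$ and $(y,z)$ are adjacent whenever $x<y<z$ (these are the only edges). $G[W]$ denotes the subgraph of $G$ induced by $W$. -}

module Defs where

open import Data.Nat using (ℕ; _+_; _∸_; _^_; _≤_; _<_)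
open import Data.Fin using (Fin)
open import Data.Product using (_×_; _,_; Σ-syntax)
open import Data.Sum using (_⊎_)
open import Relation.Nullary using (¬_)
open import Relation.Binary.PropositionalEquality using (_≡_; _≢_)

Pair : Set
Pair = ℕ × ℕ

ShiftVertex : ℕ → Pair → Set
ShiftVertex N (x , y) = (1 ≤ x) × (x < y) × (y ≤ N)

-- Adjacency in the shift graph: (x,y) ~ (y,z) with x<y<z (the order
-- conditions are part of vertex membership); symmetric closure.
ShiftAdj : Pair → Pair → Set
ShiftAdj (x , y) (y' , z) = (y ≡ y') ⊎ (z ≡ x)

IsProperColouring : (Pair → Set) → (k : ℕ) → (Pair → Fin k) → Set
IsProperColouring P k c =
  ∀ u v → P u → P v → ShiftAdj u v → c u ≢ c v

Colourable : (Pair → Set) → ℕ → Set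
Colourable P k = Σ[ c ∈ (Pair → Fin k) ] IsProperColouring P k c

ChromaticNumberIs : (Pair → Set) → ℕ → Set
ChromaticNumberIs P k = Colourable P k × (∀ m → m < k → ¬ Colourable P m)

-- z ∈ I_ℓ = [2^ℓ, 2^n - 2^(n-ℓ) + 2]  (for ℓ ≤ n, the subtraction is exact)
InI : ℕ → ℕ → ℕ → Set
InI n ℓ z = (2 ^ ℓ ≤ z) × (z ≤ 2 ^ n ∸ 2 ^ (n ∸ ℓ) + 2)

InW : ℕ → Pair → Set
InW n (x , y) =
  ShiftVertex (2 ^ n + 1) (x , y) × (Σ[ ℓ ∈ ℕ ] ((ℓ ≤ n) × InI n ℓ x × InI n ℓ y))

-- Upper bound: colour (x , y) by a bit position at which y − 1 has a one and x − 1 a zero;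
-- for consecutive pairs (x , y), (y , z) that bit of y − 1 would have to be both one and zero.
--
-- Lower bound: write W_a for W with parameter a. By induction on a, W_a has no proper colouring
-- with colours below a. The step is a halving lemma: for every boolean labelling of
-- [1, 2^(a+1) + 1] there is a strictly increasing ψ on [1, 2^a + 1] that maps each interval of
-- W_a into an interval of W_(a+1) and whose values are labelled true … true false … false.
-- Label z true when some pair (h , z) of W_(a+1) has the top colour a. Then no pair (ψ i , ψ j)
-- has colour a: if ψ i is labelled true, properness forbids it, and if ψ j is labelled false,
-- no pair ending in ψ j has colour a. Pulling back along ψ therefore colours W_a with a colours.
--
-- For the halving lemma, walk up on true and down on false, cut at a highest point τ of
-- height e, and let ψ enumerate the trues before τ except the first ⌊e/2⌋, followed by the
-- falses after τ. Choosing the last highest point when e is even and the first when e is odd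
-- makes the parity counts work out, so that ψ maps each I_j into I_j or I_(j+1).

module Submission where

open import Defs
open import Data.Nat using (ℕ; zero; suc; pred; NonZero; _+_; _*_; _∸_; _^_; ⌊_/2⌋; ⌈_/2⌉)
open import Data.Nat using (_≤_; _<_; z≤n; s≤s; z<s; _≤′_; ≤′-refl; ≤′-step; _≤?_; _<?_; _≟_)
open import Data.Nat.Properties
open import Data.Nat.Tactic.RingSolver using (solve-∀)
open import Data.Bool using (Bool; true; false; not; _∧_; if_then_else_; T)
open import Data.Bool.Properties using (T-∧)
open import Data.Product using (_×_; _,_; ∃-syntax; proj₁)
open import Data.Sum using (_⊎_; inj₁; inj₂)
open import Data.Empty using (⊥-elim)
open import Data.Fin using (Fin; toℕ; fromℕ<)
open import Data.Fin.Properties using (toℕ-fromℕ<; toℕ-injective; toℕ<n)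
open import Function using (_∘_; Equivalence)
open import Relation.Nullary using (¬_; ¬?; Dec; yes; no; does)
open import Relation.Nullary.Decidable
  using (T?; dec-true; dec-false; map′; _×-dec_; isYes; toWitness; toWitnessFalse)
open import Relation.Unary using (Decidable)
open import Relation.Binary.PropositionalEquality
  using (_≡_; _≢_; refl; sym; trans; cong; subst; module ≡-Reasoning)

module _ {P : ℕ → Set} (P? : Decidable P) where

  -- The least t ≤ n with P t, and n if there is none.
  least : ℕ → ℕ
  least zero = zero
  least (suc n) with P? (least n)
  ... | yes _ = least n
  ... | no  _ = suc n

  least≤ : ∀ n → least n ≤ n
  least≤ zero = z≤n
  least≤ (suc n) with P? (least n)
  ... | yes _ = m≤n⇒m≤1+n (least≤ n)
  ... | no  _ = ≤-refl

  least-found-or-top : ∀ n → P (least n) ⊎ least n ≡ n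
  least-found-or-top zero = inj₂ refl
  least-found-or-top (suc n) with P? (least n)
  ... | yes p = inj₁ p
  ... | no  _ = inj₂ refl

  least-minimal : ∀ n {t} → t < least n → ¬ P t
  least-minimal (suc n) {t} t< with P? (least n) | least-found-or-top n
  ... | yes _  | _ = least-minimal n t<
  ... | no ¬p  | inj₁ p = ⊥-elim (¬p p)
  ... | no ¬p  | inj₂ eq with m≤n⇒m<n∨m≡n (≤-pred t<)
  ...   | inj₁ t<n = least-minimal n (subst (t <_) (sym eq) t<n)
  ...   | inj₂ refl = ¬p ∘ subst P (sym eq)

  least-≤ : ∀ n {t} → P t → least n ≤ t
  least-≤ n Pt = ≮⇒≥ (λ t< → least-minimal n t< Pt)

  least-sound : ∀ n {t} → t ≤ n → P t → P (least n)
  least-sound n {t} t≤n Pt with least-found-or-top n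
  ... | inj₁ p = p
  ... | inj₂ eq = subst P (≤-antisym (subst (t ≤_) (sym eq) t≤n) (least-≤ n Pt)) Pt

-- Counts the positions 1 … t; position 0 is never counted.
count : (ℕ → Bool) → ℕ → ℕ
count S zero    = zero
count S (suc t) = if S (suc t) then suc (count S t) else count S t

module _ (S : ℕ → Bool) where

  count[1+t]≤1+count[t] : ∀ t → count S (suc t) ≤ suc (count S t)
  count[1+t]≤1+count[t] t with S (suc t)
  ... | true  = ≤-refl
  ... | false = n≤1+n _

  count[t]≤count[1+t] : ∀ t → count S t ≤ count S (suc t)
  count[t]≤count[1+t] t with S (suc t)
  ... | true  = n≤1+n _
  ... | false = ≤-refl

  count[t]≤t : ∀ t → count S t ≤ t
  count[t]≤t zero    = z≤n
  count[t]≤t (suc t) = ≤-trans (count[1+t]≤1+count[t] t) (s≤s (count[t]≤t t))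

  count-mono : ∀ {t u} → t ≤ u → count S t ≤ count S u
  count-mono = go ∘ ≤⇒≤′
    where
    go : ∀ {t u} → t ≤′ u → count S t ≤ count S u
    go ≤′-refl       = ≤-refl
    go (≤′-step t≤u) = ≤-trans (go t≤u) (count[t]≤count[1+t] _)

  count[d+t]≤d+count[t] : ∀ d t → count S (d + t) ≤ d + count S t
  count[d+t]≤d+count[t] zero    t = ≤-refl
  count[d+t]≤d+count[t] (suc d) t =
    ≤-trans (count[1+t]≤1+count[t] (d + t)) (s≤s (count[d+t]≤d+count[t] d t))

  count+count-not : ∀ t → count S t + count (not ∘ S) t ≡ t
  count+count-not zero = refl
  count+count-not (suc t) with S (suc t)
  ... | true  = cong suc (count+count-not t)
  ... | false = trans (+-suc _ _) (cong suc (count+count-not t))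

dropFirst : ℕ → (ℕ → Bool) → ℕ → Bool
dropFirst h S s = S s ∧ does (h <? count S s)

count-dropFirst : ∀ h S t → count (dropFirst h S) t ≡ count S t ∸ h
count-dropFirst h S zero = sym (0∸n≡0 h)
count-dropFirst h S (suc t) with S (suc t)
... | false = count-dropFirst h S t
... | true with h ≤? count S t
...   | yes h≤ rewrite dec-true (h <? suc (count S t)) (s≤s h≤) =
  trans (cong suc (count-dropFirst h S t)) (sym (+-∸-assoc 1 h≤))
...   | no  h≰ rewrite dec-false (h <? suc (count S t)) (h≰ ∘ ≤-pred) =
  trans (count-dropFirst h S t) (trans (m≤n⇒m∸n≡0 (<⇒≤ (≰⇒> h≰))) (sym (m≤n⇒m∸n≡0 (≰⇒> h≰))))

count-agree : ∀ {S S′ τ t} → τ ≤ t → (∀ {s} → τ < s → s ≤ t → S s ≡ S′ s) →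
              count S t + count S′ τ ≡ count S τ + count S′ t
count-agree = go ∘ ≤⇒≤′
  where
  go : ∀ {S S′ τ t} → τ ≤′ t → (∀ {s} → τ < s → s ≤ t → S s ≡ S′ s) →
       count S t + count S′ τ ≡ count S τ + count S′ t
  go ≤′-refl _ = refl
  go {S} {S′} {τ} {suc t} (≤′-step τ≤t) agree
    with S (suc t) | S′ (suc t) | agree (s≤s (≤′⇒≤ τ≤t)) ≤-refl
       | go τ≤t (λ τ<s s≤t → agree τ<s (m≤n⇒m≤1+n s≤t))
  ... | true  | .true  | refl | ih = trans (cong suc ih) (sym (+-suc _ _))
  ... | false | .false | refl | ih = ih

record IsArgmax (g : ℕ → ℕ) (n τ : ℕ) : Set where
  field
    τ≤n     : τ ≤ n
    maximal : ∀ {t} → t ≤ n → g t ≤ g τ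

module _ (g : ℕ → ℕ) where

  lastArgmax : ∀ n → ∃[ τ ] (IsArgmax g n τ × (∀ {t} → τ < t → t ≤ n → g t < g τ))
  lastArgmax zero =
    zero , record { τ≤n = z≤n ; maximal = λ { z≤n → ≤-refl } } , λ 0<t t≤0 → ⊥-elim (<⇒≱ 0<t t≤0)
  lastArgmax (suc n) with lastArgmax n
  ... | τ , argmax , later with g τ ≤? g (suc n)
  ...   | yes gτ≤ = suc n , record { τ≤n = ≤-refl ; maximal = maximal′ } , λ n< t≤ → ⊥-elim (<⇒≱ n< t≤)
    where
    open IsArgmax argmax
    maximal′ : ∀ {t} → t ≤ suc n → g t ≤ g (suc n)
    maximal′ t≤ with m≤n⇒m<n∨m≡n t≤
    ... | inj₁ t<  = ≤-trans (maximal (≤-pred t<)) gτ≤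
    ... | inj₂ refl = ≤-refl
  ...   | no gτ≰ = τ , record { τ≤n = m≤n⇒m≤1+n τ≤n ; maximal = maximal′ } , later′
    where
    open IsArgmax argmax
    maximal′ : ∀ {t} → t ≤ suc n → g t ≤ g τ
    maximal′ t≤ with m≤n⇒m<n∨m≡n t≤
    ... | inj₁ t<  = maximal (≤-pred t<)
    ... | inj₂ refl = <⇒≤ (≰⇒> gτ≰)
    later′ : ∀ {t} → τ < t → t ≤ suc n → g t < g τ
    later′ τ< t≤ with m≤n⇒m<n∨m≡n t≤
    ... | inj₁ t<  = later τ< (≤-pred t<)
    ... | inj₂ refl = ≰⇒> gτ≰

  firstArgmax : ∀ n → ∃[ τ ] (IsArgmax g n τ × (∀ {t} → t < τ → g t < g τ))
  firstArgmax zero =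
    zero , record { τ≤n = z≤n ; maximal = λ { z≤n → ≤-refl } } , λ ()
  firstArgmax (suc n) with firstArgmax n
  ... | τ , argmax , earlier with g τ <? g (suc n)
  ...   | yes gτ< = suc n , record { τ≤n = ≤-refl ; maximal = maximal′ } , earlier′
    where
    open IsArgmax argmax
    maximal′ : ∀ {t} → t ≤ suc n → g t ≤ g (suc n)
    maximal′ t≤ with m≤n⇒m<n∨m≡n t≤
    ... | inj₁ t<  = ≤-trans (maximal (≤-pred t<)) (<⇒≤ gτ<)
    ... | inj₂ refl = ≤-refl
    earlier′ : ∀ {t} → t < suc n → g t < g (suc n)
    earlier′ t< = ≤-<-trans (maximal (≤-pred t<)) gτ<
  ...   | no gτ≮ = τ , record { τ≤n = m≤n⇒m≤1+n τ≤n ; maximal = maximal′ } , earlier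
    where
    open IsArgmax argmax
    maximal′ : ∀ {t} → t ≤ suc n → g t ≤ g τ
    maximal′ t≤ with m≤n⇒m<n∨m≡n t≤
    ... | inj₁ t<  = maximal (≤-pred t<)
    ... | inj₂ refl = ≮⇒≥ gτ≮

  argmax-value : ∀ {n τ τ′} → IsArgmax g n τ → IsArgmax g n τ′ → g τ′ ≡ g τ
  argmax-value argmax argmax′ =
    ≤-antisym (maximal argmax (τ≤n argmax′)) (maximal argmax′ (τ≤n argmax))
    where open IsArgmax

x+x≤1+y+y⇒x≤y : ∀ {x y} → x + x ≤ suc (y + y) → x ≤ y
x+x≤1+y+y⇒x≤y {x} {y} le =
  ≮⇒≥ λ y<x → <⇒≱ (≤-trans (s≤s (≤-reflexive (sym (+-suc y y)))) (+-mono-≤ y<x y<x)) le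

parity : ∀ e → ∃[ h ] (e ≡ h + h ⊎ e ≡ h + suc h)
parity zero = zero , inj₁ refl
parity (suc e) with parity e
... | h , inj₁ refl = h , inj₂ (sym (+-suc h h))
... | h , inj₂ refl = suc h , inj₁ refl

x+y≤x*y+1 : ∀ {x y} → 1 ≤ x → 1 ≤ y → x + y ≤ x * y + 1
x+y≤x*y+1 {suc x} {suc y} _ _ = begin
  suc x + suc y         ≤⟨ m≤m+n (suc x + suc y) (x * y) ⟩
  suc x + suc y + x * y ≡⟨ lemma x y ⟩
  suc x * suc y + 1     ∎
  where
  open ≤-Reasoning
  lemma : ∀ x y → suc x + suc y + x * y ≡ suc x * suc y + 1
  lemma = solve-∀

1≤2^ : ∀ n → 1 ≤ 2 ^ n
1≤2^ = m^n>0 2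

top : ℕ → ℕ → ℕ
top n ℓ = 2 ^ n ∸ 2 ^ (n ∸ ℓ) + 2

top-+ : ∀ n ℓ → top n ℓ + 2 ^ (n ∸ ℓ) ≡ 2 ^ n + 2
top-+ n ℓ = begin
  2 ^ n ∸ Y + 2 + Y ≡⟨ lemma (2 ^ n ∸ Y) Y ⟩
  2 ^ n ∸ Y + Y + 2 ≡⟨ cong (_+ 2) (m∸n+n≡m (^-monoʳ-≤ 2 (m∸n≤m n ℓ))) ⟩
  2 ^ n + 2         ∎
  where
  open ≡-Reasoning
  Y = 2 ^ (n ∸ ℓ)
  lemma : ∀ a y → a + 2 + y ≡ a + y + 2
  lemma = solve-∀

top≤ : ∀ n ℓ → top n ℓ ≤ 2 ^ n + 1
top≤ n ℓ = +-cancelʳ-≤ 1 (top n ℓ) (2 ^ n + 1) (begin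
  top n ℓ + 1            ≤⟨ +-monoʳ-≤ (top n ℓ) (1≤2^ (n ∸ ℓ)) ⟩
  top n ℓ + 2 ^ (n ∸ ℓ)  ≡⟨ top-+ n ℓ ⟩
  2 ^ n + 2              ≡⟨ +-assoc (2 ^ n) 1 1 ⟨
  2 ^ n + 1 + 1          ∎)
  where open ≤-Reasoning

top-suc : ∀ n ℓ → top (suc n) (suc ℓ) ≡ top n ℓ + 2 ^ n
top-suc n ℓ = +-cancelʳ-≡ Y (top (suc n) (suc ℓ)) (top n ℓ + 2 ^ n) (begin
  top (suc n) (suc ℓ) + Y  ≡⟨ top-+ (suc n) (suc ℓ) ⟩
  2 ^ suc n + 2            ≡⟨ lemma (2 ^ n) ⟩
  2 ^ n + 2 + 2 ^ n        ≡⟨ cong (_+ 2 ^ n) (top-+ n ℓ) ⟨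
  top n ℓ + Y + 2 ^ n      ≡⟨ swap (top n ℓ) Y (2 ^ n) ⟩
  top n ℓ + 2 ^ n + Y      ∎)
  where
  open ≡-Reasoning
  Y = 2 ^ (n ∸ ℓ)
  lemma : ∀ d → 2 * d + 2 ≡ d + 2 + d
  lemma = solve-∀
  swap : ∀ a b c → a + b + c ≡ a + c + b
  swap = solve-∀

2^[1+n∸ℓ] : ∀ {n ℓ} → ℓ ≤ n → 2 ^ (suc n ∸ ℓ) ≡ 2 * 2 ^ (n ∸ ℓ)
2^[1+n∸ℓ] ℓ≤n = cong (2 ^_) (+-∸-assoc 1 ℓ≤n)

top-double : ∀ {n ℓ} → ℓ ≤ n → top (suc n) ℓ + 2 ≡ top n ℓ + top n ℓ
top-double {n} {ℓ} ℓ≤n = +-cancelʳ-≡ (2 * Y) (top (suc n) ℓ + 2) (top n ℓ + top n ℓ) (begin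
  top (suc n) ℓ + 2 + 2 * Y            ≡⟨ cong (top (suc n) ℓ + 2 +_) (2^[1+n∸ℓ] ℓ≤n) ⟨
  top (suc n) ℓ + 2 + 2 ^ (suc n ∸ ℓ)  ≡⟨ swap (top (suc n) ℓ) 2 _ ⟩
  top (suc n) ℓ + 2 ^ (suc n ∸ ℓ) + 2  ≡⟨ cong (_+ 2) (top-+ (suc n) ℓ) ⟩
  2 ^ suc n + 2 + 2                    ≡⟨ double (2 ^ n) ⟩
  2 * (2 ^ n + 2)                      ≡⟨ cong (2 *_) (top-+ n ℓ) ⟨
  2 * (top n ℓ + Y)                    ≡⟨ distrib (top n ℓ) Y ⟩
  top n ℓ + top n ℓ + 2 * Y            ∎)
  where
  open ≡-Reasoning
  Y = 2 ^ (n ∸ ℓ)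
  swap : ∀ a b c → a + b + c ≡ a + c + b
  swap = solve-∀
  double : ∀ d → 2 * d + 2 + 2 ≡ 2 * (d + 2)
  double = solve-∀
  distrib : ∀ a b → 2 * (a + b) ≡ a + a + 2 * b
  distrib = solve-∀

2^suc≤top : ∀ {n ℓ} → ℓ ≤ n → 2 ^ suc ℓ ≤ top (suc n) ℓ
2^suc≤top {n} {ℓ} ℓ≤n = +-cancelʳ-≤ (2 * Y) (2 * X) (top (suc n) ℓ) (begin
  2 * X + 2 * Y                      ≡⟨ *-distribˡ-+ 2 X Y ⟨
  2 * (X + Y)                        ≤⟨ *-monoʳ-≤ 2 (x+y≤x*y+1 (1≤2^ ℓ) (1≤2^ (n ∸ ℓ))) ⟩
  2 * (X * Y + 1)                    ≡⟨ cong (λ e → 2 * (e + 1)) 2^n≡X*Y ⟨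
  2 * (2 ^ n + 1)                    ≡⟨ lemma (2 ^ n) ⟩
  2 ^ suc n + 2                      ≡⟨ top-+ (suc n) ℓ ⟨
  top (suc n) ℓ + 2 ^ (suc n ∸ ℓ)    ≡⟨ cong (top (suc n) ℓ +_) (2^[1+n∸ℓ] ℓ≤n) ⟩
  top (suc n) ℓ + 2 * Y              ∎)
  where
  open ≤-Reasoning
  X = 2 ^ ℓ
  Y = 2 ^ (n ∸ ℓ)
  2^n≡X*Y : 2 ^ n ≡ X * Y
  2^n≡X*Y = trans (cong (2 ^_) (sym (m+[n∸m]≡n ℓ≤n))) (^-distribˡ-+-* 2 ℓ (n ∸ ℓ))
  lemma : ∀ d → 2 * (d + 1) ≡ 2 * d + 2
  lemma = solve-∀

-- InW a (i , j) without its vertex bounds, which the intervals imply (W⇒InW).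
W : ℕ → ℕ → ℕ → Set
W a i j = i < j × ∃[ ℓ ] (ℓ ≤ a × InI a ℓ i × InI a ℓ j)

W⇒ShiftVertex : ∀ {a i j} → W a i j → ShiftVertex (2 ^ a + 1) (i , j)
W⇒ShiftVertex {a} (i<j , ℓ , _ , (2^ℓ≤i , _) , (_ , j≤top)) =
  ≤-trans (1≤2^ ℓ) 2^ℓ≤i , i<j , ≤-trans j≤top (top≤ a ℓ)

W⇒InW : ∀ {a i j} → W a i j → InW a (i , j)
W⇒InW ij@(_ , intervals) = W⇒ShiftVertex ij , intervals

W? : ∀ a i j → Dec (W a i j)
W? a i j = (i <? j) ×-dec map′ (λ (ℓ , ℓ<1+a , z) → ℓ , ≤-pred ℓ<1+a , z)
                               (λ (ℓ , ℓ≤a , z) → ℓ , s≤s ℓ≤a , z)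
                               (anyUpTo? (λ ℓ → InI? ℓ i ×-dec InI? ℓ j) (suc a))
  where
  InI? : ∀ ℓ z → Dec (InI a ℓ z)
  InI? ℓ z = (2 ^ ℓ ≤? z) ×-dec (z ≤? top a ℓ)

record Embeds (a b : ℕ) (φ : ℕ → ℕ) : Set where
  field
    strictlyMonotone : ∀ {i j} → ShiftVertex (2 ^ a + 1) (i , j) → φ i < φ j
    intervals        : ∀ {ℓ} → ℓ ≤ a → ∃[ ℓ′ ] (ℓ′ ≤ b × (∀ {z} → InI a ℓ z → InI b ℓ′ (φ z)))

embeds-W : ∀ {a b φ i j} → Embeds a b φ → W a i j → W b (φ i) (φ j)
embeds-W emb ij@(_ , ℓ , ℓ≤a , i∈I , j∈I) with Embeds.intervals emb ℓ≤a
... | ℓ′ , ℓ′≤b , maps =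
  Embeds.strictlyMonotone emb (W⇒ShiftVertex ij) , ℓ′ , ℓ′≤b , maps i∈I , maps j∈I

-- In the first case of interval the enumeration of S pushes I_j of W_k up into I_(j+1) of
-- W_(k+1); in the second it keeps I_j inside I_j.
record Admissible (k : ℕ) (S : ℕ → Bool) : Set where
  field
    enough   : 2 ^ k + 1 ≤ count S (2 ^ suc k + 1)
    interval : ∀ {j} → j ≤ k → count S (pred (2 ^ suc j)) < 2 ^ j ⊎ top k j ≤ count S (top (suc k) j)

module Enumeration {k S} (admissible : Admissible k S) where

  open Admissible admissible

  reaches? : ∀ i → Decidable (λ t → i ≤ count S t)
  reaches? i t = i ≤? count S t

  -- The i-th element of S.
  nth : ℕ → ℕ
  nth i = least (reaches? i) (2 ^ suc k + 1)

  nth-≤ : ∀ {i t} → i ≤ count S t → nth i ≤ t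
  nth-≤ {i} = least-≤ (reaches? i) (2 ^ suc k + 1)

  ≤-count-nth : ∀ {i} → i ≤ 2 ^ k + 1 → i ≤ count S (nth i)
  ≤-count-nth {i} i≤M = least-sound (reaches? i) (2 ^ suc k + 1) ≤-refl (≤-trans i≤M enough)

  count-nth≤ : ∀ i → count S (nth i) ≤ i
  count-nth≤ i with nth i | least-minimal (reaches? i) (2 ^ suc k + 1)
  ... | zero  | _      = z≤n
  ... | suc t | before = ≤-trans (count[1+t]≤1+count[t] S t) (≰⇒> (before ≤-refl))

  <-nth : ∀ {i t} → i ≤ 2 ^ k + 1 → count S t < i → t < nth i
  <-nth i≤M below = ≰⇒> λ nth≤t → <⇒≱ below (≤-trans (≤-count-nth i≤M) (count-mono S nth≤t))

  nth-mono-≤ : ∀ {i j} → i ≤ j → j ≤ 2 ^ k + 1 → nth i ≤ nth j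
  nth-mono-≤ i≤j j≤M = nth-≤ (≤-trans i≤j (≤-count-nth j≤M))

  nth-mono-< : ∀ {i j} → i < j → j ≤ 2 ^ k + 1 → nth i < nth j
  nth-mono-< {i} {j} i<j j≤M = ≰⇒> λ nth-j≤nth-i → <⇒≱ i<j (begin
    j                ≤⟨ ≤-count-nth j≤M ⟩
    count S (nth j)  ≤⟨ count-mono S nth-j≤nth-i ⟩
    count S (nth i)  ≤⟨ count-nth≤ i ⟩
    i                ∎)
    where open ≤-Reasoning

  ≤-nth : ∀ {i} → i ≤ 2 ^ k + 1 → i ≤ nth i
  ≤-nth i≤M = ≤-trans (≤-count-nth i≤M) (count[t]≤t S _)

  nth≤+ : ∀ {i} → i ≤ 2 ^ k + 1 → nth i ≤ i + 2 ^ k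
  nth≤+ {i} i≤M = nth-≤ (+-cancelˡ-≤ (M ∸ i) i (count S (i + 2 ^ k)) (begin
    M ∸ i + i                     ≡⟨ m∸n+n≡m i≤M ⟩
    M                             ≤⟨ enough ⟩
    count S (2 ^ suc k + 1)       ≡⟨ cong (count S) N≡ ⟩
    count S (M ∸ i + (i + 2 ^ k)) ≤⟨ count[d+t]≤d+count[t] S (M ∸ i) (i + 2 ^ k) ⟩
    M ∸ i + count S (i + 2 ^ k)   ∎))
    where
    open ≤-Reasoning
    M = 2 ^ k + 1
    N≡ : 2 ^ suc k + 1 ≡ M ∸ i + (i + 2 ^ k)
    N≡ = begin-equality
      2 ^ suc k + 1        ≡⟨ double (2 ^ k) ⟩
      M + 2 ^ k            ≡⟨ cong (_+ 2 ^ k) (m∸n+n≡m i≤M) ⟨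
      M ∸ i + i + 2 ^ k    ≡⟨ +-assoc (M ∸ i) i (2 ^ k) ⟩
      M ∸ i + (i + 2 ^ k)  ∎
      where
      double : ∀ d → 2 * d + 1 ≡ d + 1 + d
      double = solve-∀

  nth-∈ : ∀ {i} → 1 ≤ i → i ≤ 2 ^ k + 1 → T (S (nth i))
  nth-∈ {i} 1≤i i≤M with nth i | ≤-count-nth i≤M | least-minimal (reaches? i) (2 ^ suc k + 1)
  ... | zero  | i≤0 | _      = ⊥-elim (<⇒≱ 1≤i i≤0)
  ... | suc t | i≤  | before with S (suc t)
  ...   | true  = _
  ...   | false = before ≤-refl i≤

  nth-embeds : Embeds k (suc k) nth
  nth-embeds = record
    { strictlyMonotone = λ (_ , i<j , j≤M) → nth-mono-< i<j j≤M
    ; intervals        = intervals′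
    }
    where
    ≤M : ∀ j {z} → z ≤ top k j → z ≤ 2 ^ k + 1
    ≤M j z≤top = ≤-trans z≤top (top≤ k j)

    intervals′ : ∀ {j} → j ≤ k → ∃[ j′ ] (j′ ≤ suc k × (∀ {z} → InI k j z → InI (suc k) j′ (nth z)))
    intervals′ {j} j≤k with interval j≤k
    ... | inj₁ sparse = suc j , s≤s j≤k , λ z∈I → lower z∈I , upper z∈I
      where
      open ≤-Reasoning
      lower : ∀ {z} → InI k j z → 2 ^ suc j ≤ nth z
      lower {z} (2^j≤z , z≤top) = begin
        2 ^ suc j               ≡⟨ suc-pred (2 ^ suc j) {{m^n≢0 2 (suc j)}} ⟨
        suc (pred (2 ^ suc j))  ≤⟨ <-nth (≤-trans 2^j≤z (≤M j z≤top)) sparse ⟩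
        nth (2 ^ j)             ≤⟨ nth-mono-≤ 2^j≤z (≤M j z≤top) ⟩
        nth z                   ∎
      upper : ∀ {z} → InI k j z → nth z ≤ top (suc k) (suc j)
      upper {z} (_ , z≤top) = begin
        nth z                ≤⟨ nth≤+ (≤M j z≤top) ⟩
        z + 2 ^ k            ≤⟨ +-monoˡ-≤ (2 ^ k) z≤top ⟩
        top k j + 2 ^ k      ≡⟨ top-suc k j ⟨
        top (suc k) (suc j)  ∎
    ... | inj₂ dense = j , m≤n⇒m≤1+n j≤k , λ (2^j≤z , z≤top) →
      ≤-trans 2^j≤z (≤-nth (≤M j z≤top)) , ≤-trans (nth-mono-≤ z≤top (top≤ k j)) (nth-≤ dense)

module Walk (k : ℕ) (lab : ℕ → Bool) where

  N : ℕ
  N = 2 ^ suc k + 1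

  trues falses : ℕ → ℕ
  trues  = count lab
  falses = count (not ∘ lab)

  -- The height trues t − falses t of the walk, shifted by falses N to stay in ℕ.
  cut : ℕ → ℕ
  cut t = trues t + (falses N ∸ falses t)

  cut+falses : ∀ {t} → t ≤ N → cut t + falses t ≡ trues t + falses N
  cut+falses {t} t≤N =
    trans (+-assoc (trues t) _ _) (cong (trues t +_) (m∸n+n≡m (count-mono (not ∘ lab) t≤N)))

  module Peak {τ e} (τ≤N : τ ≤ N) (trues-τ : trues τ ≡ falses τ + e) where

    private
      at-peak : ∀ t → cut τ + falses t + falses τ ≡ e + falses t + (falses N + falses τ)
      at-peak t = begin
        cut τ + falses t + falses τ         ≡⟨ swap (cut τ) (falses t) (falses τ) ⟩
        cut τ + falses τ + falses t         ≡⟨ cong (_+ falses t) (cut+falses τ≤N) ⟩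
        trues τ + falses N + falses t       ≡⟨ cong (λ a → a + falses N + falses t) trues-τ ⟩
        falses τ + e + falses N + falses t  ≡⟨ rearrange (falses τ) e (falses N) (falses t) ⟩
        e + falses t + (falses N + falses τ) ∎
        where
        open ≡-Reasoning
        swap : ∀ a b c → a + b + c ≡ a + c + b
        swap = solve-∀
        rearrange : ∀ a b c d → a + b + c + d ≡ b + d + (c + a)
        rearrange = solve-∀

      bounded : ∀ {t x A} → A + falses N ≡ x + falses t → x ≤ cut τ → A ≤ e + falses t
      bounded {t} {x} {A} eq x≤cut = +-cancelʳ-≤ (falses N + falses τ) A (e + falses t) (begin
        A + (falses N + falses τ)  ≡⟨ +-assoc A (falses N) (falses τ) ⟨
        A + falses N + falses τ    ≡⟨ cong (_+ falses τ) eq ⟩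
        x + falses t + falses τ    ≤⟨ +-monoˡ-≤ (falses τ) (+-monoˡ-≤ (falses t) x≤cut) ⟩
        cut τ + falses t + falses τ ≡⟨ at-peak t ⟩
        e + falses t + (falses N + falses τ) ∎)
        where open ≤-Reasoning

    below : ∀ {t} → t ≤ N → cut t ≤ cut τ → trues t ≤ e + falses t
    below {t} t≤N = bounded {t} (sym (cut+falses t≤N))

    strictly-below : ∀ {t} → t ≤ N → cut t < cut τ → suc (trues t) ≤ e + falses t
    strictly-below {t} t≤N = bounded {t} (sym (cong suc (cut+falses t≤N)))

    level : ∀ {t} → t ≤ N → cut t ≡ cut τ → trues t ≡ falses t + e
    level {t} t≤N same = trans (+-cancelʳ-≡ (falses N + falses τ) (trues t) (e + falses t) (begin
      trues t + (falses N + falses τ)  ≡⟨ +-assoc (trues t) (falses N) (falses τ) ⟨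
      trues t + falses N + falses τ    ≡⟨ cong (_+ falses τ) (cut+falses t≤N) ⟨
      cut t + falses t + falses τ      ≡⟨ cong (λ x → x + falses t + falses τ) same ⟩
      cut τ + falses t + falses τ      ≡⟨ at-peak t ⟩
      e + falses t + (falses N + falses τ) ∎)) (+-comm e (falses t))
      where open ≡-Reasoning

  keep : ℕ → ℕ → ℕ → Bool
  keep τ h t = if does (t ≤? τ) then dropFirst h lab t else not (lab t)

  keep-before : ∀ {τ h t} → t ≤ τ → keep τ h t ≡ dropFirst h lab t
  keep-before {τ} {h} {t} t≤τ rewrite dec-true (t ≤? τ) t≤τ = refl

  keep-after : ∀ {τ h t} → τ < t → keep τ h t ≡ not (lab t)
  keep-after {τ} {h} {t} τ<t rewrite dec-false (t ≤? τ) (<⇒≱ τ<t) = refl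

  kept-before : ∀ {τ h t} → t ≤ τ → T (keep τ h t) → T (lab t)
  kept-before t≤τ kept = proj₁ (Equivalence.to T-∧ (subst T (keep-before t≤τ) kept))

  kept-after : ∀ {τ h t} → τ < t → T (keep τ h t) → T (not (lab t))
  kept-after τ<t = subst T (keep-after τ<t)

  count-keep-before : ∀ {τ h t} → t ≤ τ → count (keep τ h) t ≡ trues t ∸ h
  count-keep-before {τ} {h} {t} t≤τ = begin
    count (keep τ h) t         ≡⟨ +-identityʳ _ ⟨
    count (keep τ h) t + 0     ≡⟨ count-agree z≤n (λ _ s≤t → keep-before (≤-trans s≤t t≤τ)) ⟩
    count (dropFirst h lab) t  ≡⟨ count-dropFirst h lab t ⟩
    trues t ∸ h                ∎
    where open ≡-Reasoning

  -- h and c are ⌊e/2⌋ and ⌈e/2⌉ for the height e of the walk at τ.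
  record Balanced (τ h c : ℕ) : Set where
    field
      τ≤N             : τ ≤ N
      trues-τ         : trues τ ≡ falses τ + (h + c)
      bound-N         : trues N ≤ c + c + falses N
      after-or-before : ∀ {p r} → p ≤ r → r ≤ N →
                        (τ ≤ r × suc (trues r) ≤ c + c + falses r) ⊎ (p ≤ τ × trues p ≤ h + h + falses p)

  module _ {τ h c} (balanced : Balanced τ h c) where

    open Balanced balanced

    count-keep-after : ∀ {t} → τ ≤ t → count (keep τ h) t ≡ c + falses t
    count-keep-after {t} τ≤t = +-cancelʳ-≡ (falses τ) (count (keep τ h) t) (c + falses t) (begin
      count (keep τ h) t + falses τ      ≡⟨ count-agree τ≤t (λ τ<s _ → keep-after τ<s) ⟩
      count (keep τ h) τ + falses t      ≡⟨ cong (_+ falses t) (count-keep-before {τ} {h} ≤-refl) ⟩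
      trues τ ∸ h + falses t             ≡⟨ cong (λ a → a ∸ h + falses t) trues-τ ⟩
      falses τ + (h + c) ∸ h + falses t  ≡⟨ cong (λ a → a ∸ h + falses t) (shuffle (falses τ) h c) ⟩
      h + (falses τ + c) ∸ h + falses t  ≡⟨ cong (_+ falses t) (m+n∸m≡n h (falses τ + c)) ⟩
      falses τ + c + falses t            ≡⟨ shuffle′ (falses τ) c (falses t) ⟩
      c + falses t + falses τ            ∎)
      where
      open ≡-Reasoning
      shuffle : ∀ f h c → f + (h + c) ≡ h + (f + c)
      shuffle = solve-∀
      shuffle′ : ∀ f c g → f + c + g ≡ c + g + f
      shuffle′ = solve-∀

    ≤-count-keep-after : ∀ {r m s} → τ ≤ r → r + s ≡ m + m → trues r + s ≤ suc (c + c + falses r) →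
                         m ≤ count (keep τ h) r
    ≤-count-keep-after {r} {m} {s} τ≤r r+s≡ bound =
      subst (m ≤_) (sym (count-keep-after τ≤r)) (x+x≤1+y+y⇒x≤y (begin
      m + m                              ≡⟨ r+s≡ ⟨
      r + s                              ≡⟨ cong (_+ s) (count+count-not lab r) ⟨
      trues r + falses r + s             ≡⟨ swap (trues r) (falses r) s ⟩
      trues r + s + falses r             ≤⟨ +-monoˡ-≤ (falses r) bound ⟩
      suc (c + c + falses r) + falses r  ≡⟨ regroup c (falses r) ⟩
      suc (c + falses r + (c + falses r)) ∎))
      where
      open ≤-Reasoning
      swap : ∀ a b c → a + b + c ≡ a + c + b
      swap = solve-∀
      regroup : ∀ c f → suc (c + c + f) + f ≡ suc (c + f + (c + f))
      regroup = solve-∀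

    count-keep-before< : ∀ {p m} .{{_ : NonZero m}} → p ≤ τ → suc p ≡ m + m → trues p ≤ h + h + falses p →
                         count (keep τ h) p < m
    count-keep-before< {p} {m} p≤τ 1+p≡ bound = subst (_< m) (sym (count-keep-before p≤τ))
      (m<n+o⇒m∸n<o (trues p) h (x+x≤1+y+y⇒x≤y (begin
        suc (trues p) + suc (trues p)     ≡⟨ regroup (trues p) ⟩
        trues p + trues p + 2             ≤⟨ +-monoˡ-≤ 2 (+-monoʳ-≤ (trues p) bound) ⟩
        trues p + (h + h + falses p) + 2  ≡⟨ regroup′ (trues p) h (falses p) ⟩
        h + h + (trues p + falses p) + 2  ≡⟨ cong (λ x → h + h + x + 2) (count+count-not lab p) ⟩
        h + h + p + 2                     ≡⟨ shift (h + h) p ⟩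
        h + h + suc p + 1                 ≡⟨ cong (λ x → h + h + x + 1) 1+p≡ ⟩
        h + h + (m + m) + 1               ≡⟨ regroup″ h m ⟩
        suc (h + m + (h + m))             ∎)))
      where
      open ≤-Reasoning
      regroup : ∀ a → suc a + suc a ≡ a + a + 2
      regroup = solve-∀
      regroup′ : ∀ a h f → a + (h + h + f) + 2 ≡ h + h + (a + f) + 2
      regroup′ = solve-∀
      shift : ∀ a b → a + b + 2 ≡ a + suc b + 1
      shift = solve-∀
      regroup″ : ∀ h m → h + h + (m + m) + 1 ≡ suc (h + m + (h + m))
      regroup″ = solve-∀

    admissible : Admissible k (keep τ h)
    admissible = record { enough = enough ; interval = interval }
      where
      enough : 2 ^ k + 1 ≤ count (keep τ h) N
      enough = ≤-count-keep-after τ≤N (double (2 ^ k))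
                 (≤-trans (≤-reflexive (+-comm (trues N) 1)) (s≤s bound-N))
        where
        double : ∀ d → 2 * d + 1 + 1 ≡ d + 1 + (d + 1)
        double = solve-∀
      interval : ∀ {j} → j ≤ k → count (keep τ h) (pred (2 ^ suc j)) < 2 ^ j
                                 ⊎ top k j ≤ count (keep τ h) (top (suc k) j)
      interval {j} j≤k with after-or-before (≤-trans pred[n]≤n (2^suc≤top j≤k)) (top≤ (suc k) j)
      ... | inj₁ (τ≤r , bound) = inj₂ (≤-count-keep-after τ≤r (top-double j≤k)
        (≤-trans (≤-reflexive (+-comm (trues (top (suc k) j)) 2)) (s≤s bound)))
      ... | inj₂ (p≤τ , bound) = inj₁ (count-keep-before< {{m^n≢0 2 j}} p≤τ 1+p≡ bound)
        where
        1+p≡ : suc (pred (2 ^ suc j)) ≡ 2 ^ j + 2 ^ j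
        1+p≡ = trans (suc-pred (2 ^ suc j) {{m^n≢0 2 (suc j)}}) (cong (2 ^ j +_) (+-identityʳ (2 ^ j)))

  trues-at-argmax : ∀ {τ e} → IsArgmax cut N τ → trues τ ∸ falses τ ≡ e → trues τ ≡ falses τ + e
  trues-at-argmax {τ} argmax refl = sym (m+[n∸m]≡n (+-cancelʳ-≤ (falses N) (falses τ) (trues τ) (begin
    falses τ + falses N  ≡⟨ +-comm (falses τ) (falses N) ⟩
    cut 0 + falses τ     ≤⟨ +-monoˡ-≤ (falses τ) (maximal z≤n) ⟩
    cut τ + falses τ     ≡⟨ cut+falses τ≤n ⟩
    trues τ + falses N   ∎)))
    where
    open IsArgmax argmax
    open ≤-Reasoning

  balanced-at-last : ∀ {τ h} → IsArgmax cut N τ → (∀ {t} → τ < t → t ≤ N → cut t < cut τ) →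
                     trues τ ≡ falses τ + (h + h) → Balanced τ h h
  balanced-at-last {τ} {h} argmax later trues-τ = record
    { τ≤N = τ≤n ; trues-τ = trues-τ ; bound-N = below ≤-refl (maximal ≤-refl)
    ; after-or-before = after-or-before }
    where
    open IsArgmax argmax
    open Peak τ≤n trues-τ
    after-or-before : ∀ {p r} → p ≤ r → r ≤ N →
                      (τ ≤ r × suc (trues r) ≤ h + h + falses r) ⊎ (p ≤ τ × trues p ≤ h + h + falses p)
    after-or-before {p} {r} p≤r r≤N with τ <? r
    ... | yes τ<r = inj₁ (<⇒≤ τ<r , strictly-below r≤N (later τ<r r≤N))
    ... | no  τ≮r = inj₂ (≤-trans p≤r (≮⇒≥ τ≮r) , below p≤N (maximal p≤N))
      where p≤N = ≤-trans p≤r r≤N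

  balanced-at-first : ∀ {τ h} → IsArgmax cut N τ → (∀ {t} → t < τ → cut t < cut τ) →
                      trues τ ≡ falses τ + (h + suc h) → Balanced τ h (suc h)
  balanced-at-first {τ} {h} argmax earlier trues-τ = record
    { τ≤N = τ≤n ; trues-τ = trues-τ ; bound-N = bound-N ; after-or-before = after-or-before }
    where
    open IsArgmax argmax
    open Peak τ≤n trues-τ
    bound-N : trues N ≤ suc h + suc h + falses N
    bound-N = ≤-trans (below ≤-refl (maximal ≤-refl)) (+-monoˡ-≤ (falses N) (n≤1+n _))
    after-or-before : ∀ {p r} → p ≤ r → r ≤ N →
                      (τ ≤ r × suc (trues r) ≤ suc h + suc h + falses r)
                      ⊎ (p ≤ τ × trues p ≤ h + h + falses p)
    after-or-before {p} {r} p≤r r≤N with p <? τ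
    ... | yes p<τ = inj₂ (<⇒≤ p<τ , ≤-pred (subst (suc (trues p) ≤_) (cong (_+ falses p) (+-suc h h))
                                                 (strictly-below (≤-trans p≤r r≤N) (earlier p<τ))))
    ... | no  p≮τ = inj₁ (≤-trans (≮⇒≥ p≮τ) p≤r , s≤s (below r≤N (maximal r≤N)))

  balanced-split : ∃[ τ ] ∃[ h ] ∃[ c ] Balanced τ h c
  balanced-split with lastArgmax cut N
  ... | τ , argmax , later with parity (trues τ ∸ falses τ)
  ...   | h , inj₁ even = τ , h , h , balanced-at-last argmax later (trues-at-argmax argmax even)
  ...   | h , inj₂ odd with firstArgmax cut N
  ...     | τ′ , argmax′ , earlier = τ′ , h , suc h , balanced-at-first argmax′ earlier
    (Peak.level (IsArgmax.τ≤n argmax) (trues-at-argmax argmax odd) (IsArgmax.τ≤n argmax′)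
                (argmax-value cut argmax argmax′))

halving : ∀ k (lab : ℕ → Bool) → ∃[ ψ ] (Embeds k (suc k) ψ ×
          (∀ {i j} → ShiftVertex (2 ^ k + 1) (i , j) → T (lab (ψ i)) ⊎ T (not (lab (ψ j)))))
halving k lab with Walk.balanced-split k lab
... | τ , h , c , balanced = nth , nth-embeds , ordered
  where
  open Walk k lab using (admissible; kept-before; kept-after)
  open Enumeration (admissible balanced)
  ordered : ∀ {i j} → ShiftVertex (2 ^ k + 1) (i , j) → T (lab (nth i)) ⊎ T (not (lab (nth j)))
  ordered {i} {j} (1≤i , i<j , j≤M) with nth i ≤? τ
  ... | yes ≤τ = inj₁ (kept-before ≤τ (nth-∈ 1≤i (≤-trans (<⇒≤ i<j) j≤M)))
  ... | no  ≰τ = inj₂ (kept-after (<-trans (≰⇒> ≰τ) (nth-mono-< i<j j≤M))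
                                  (nth-∈ (≤-trans 1≤i (<⇒≤ i<j)) j≤M))

ProperOnW : ℕ → (Pair → ℕ) → Set
ProperOnW a c = ∀ {i j l} → W a i j → W a j l → c (i , j) ≢ c (j , l)

incoming? : ∀ a (c : Pair → ℕ) κ z → Dec (∃[ h ] (h < z × W a h z × c (h , z) ≡ κ))
incoming? a c κ z = anyUpTo? (λ h → W? a h z ×-dec (c (h , z) ≟ κ)) z

W-uncolourable : ∀ a (c : Pair → ℕ) → ProperOnW a c → ¬ (∀ {i j} → W a i j → c (i , j) < a)
W-uncolourable zero c _ below = n≮0 (below 1-2∈W₀)
  where
  1-2∈W₀ : W 0 1 2
  1-2∈W₀ = s≤s (s≤s z≤n) , 0 , z≤n , (s≤s z≤n , s≤s z≤n) , (s≤s z≤n , s≤s (s≤s z≤n))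
W-uncolourable (suc a) c proper below with halving a (isYes ∘ incoming? (suc a) c a)
... | ψ , embeds , ordered = W-uncolourable a (λ (i , j) → c (ψ i , ψ j)) proper′ below′
  where
  proper′ : ProperOnW a (λ (i , j) → c (ψ i , ψ j))
  proper′ ij jl = proper (embeds-W embeds ij) (embeds-W embeds jl)
  below′ : ∀ {i j} → W a i j → c (ψ i , ψ j) < a
  below′ {i} {j} ij = ≤∧≢⇒< (≤-pred (below ψij)) not-a
    where
    ψij = embeds-W embeds ij
    not-a : c (ψ i , ψ j) ≢ a
    not-a ψij-a with ordered (W⇒ShiftVertex ij)
    ... | inj₁ into-ψi with toWitness into-ψi
    ...   | h , _ , hψi , hψi-a = proper hψi ψij (trans hψi-a (sym ψij-a))
    not-a ψij-a | inj₂ none-into-ψj = toWitnessFalse none-into-ψj (ψ i , proj₁ ψij , ψij , ψij-a)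

odd : ℕ → Bool
odd zero          = false
odd (suc zero)    = true
odd (suc (suc u)) = odd u

bit : ℕ → ℕ → Bool
bit zero    u = odd u
bit (suc i) u = bit i ⌊ u /2⌋

halves : ∀ u → (T (odd u) × u ≡ suc (⌊ u /2⌋ + ⌊ u /2⌋)) ⊎ (¬ T (odd u) × u ≡ ⌊ u /2⌋ + ⌊ u /2⌋)
halves zero          = inj₂ ((λ ()) , refl)
halves (suc zero)    = inj₁ (_ , refl)
halves (suc (suc u)) with halves u
... | inj₁ (o , eq) = inj₁ (o , cong (suc ∘ suc) (trans eq (sym (+-suc _ _))))
... | inj₂ (e , eq) = inj₂ (e , cong suc (trans (cong suc eq) (sym (+-suc _ _))))

⌊/2⌋< : ∀ {v x} → v < 2 * x → ⌊ v /2⌋ < x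
⌊/2⌋< {v} {x} v<2x = ≰⇒> λ x≤v/2 → <⇒≱ v<2x (begin
  2 * x              ≡⟨ cong (x +_) (+-identityʳ x) ⟩
  x + x              ≤⟨ +-mono-≤ x≤v/2 x≤v/2 ⟩
  ⌊ v /2⌋ + ⌊ v /2⌋  ≤⟨ +-monoʳ-≤ ⌊ v /2⌋ (⌊n/2⌋≤⌈n/2⌉ v) ⟩
  ⌊ v /2⌋ + ⌈ v /2⌉  ≡⟨ ⌊n/2⌋+⌈n/2⌉≡n v ⟩
  v                  ∎)
  where open ≤-Reasoning

≤1+2⌊/2⌋ : ∀ v → v ≤ suc (⌊ v /2⌋ + ⌊ v /2⌋)
≤1+2⌊/2⌋ v with halves v
... | inj₁ (_ , v≡) = ≤-reflexive v≡
... | inj₂ (_ , v≡) = ≤-trans (≤-reflexive v≡) (n≤1+n _)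

Separates : ℕ → ℕ → ℕ → Set
Separates u v i = T (bit i v) × ¬ T (bit i u)

separates? : ∀ u v → Decidable (Separates u v)
separates? u v i = T? (bit i v) ×-dec ¬? (T? (bit i u))

separatingBit : ∀ n {u v} → u < v → v < 2 ^ n → ∃[ i ] (i < n × Separates u v i)
separatingBit zero    {u} u<v (s≤s v≤0) = ⊥-elim (<⇒≱ u<v (≤-trans v≤0 z≤n))
separatingBit (suc n) {u} {v} u<v v<2^1+n with ⌊ u /2⌋ <? ⌊ v /2⌋
... | yes halves< with separatingBit n halves< (⌊/2⌋< v<2^1+n)
...   | i , i<n , sep = suc i , s≤s i<n , sep
separatingBit (suc n) {u} {v} u<v _ | no halves≮ with halves u | halves v | ≮⇒≥ halves≮
... | inj₁ (_ , u≡) | _ | v/2≤u/2 = ⊥-elim (<⇒≱ u<v (begin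
  v                        ≤⟨ ≤1+2⌊/2⌋ v ⟩
  suc (⌊ v /2⌋ + ⌊ v /2⌋)  ≤⟨ s≤s (+-mono-≤ v/2≤u/2 v/2≤u/2) ⟩
  suc (⌊ u /2⌋ + ⌊ u /2⌋)  ≡⟨ u≡ ⟨
  u                        ∎))
  where open ≤-Reasoning
... | inj₂ (_ , u≡) | inj₂ (_ , v≡) | v/2≤u/2 = ⊥-elim (<⇒≱ u<v (begin
  v                        ≡⟨ v≡ ⟩
  ⌊ v /2⌋ + ⌊ v /2⌋        ≤⟨ +-mono-≤ v/2≤u/2 v/2≤u/2 ⟩
  ⌊ u /2⌋ + ⌊ u /2⌋        ≡⟨ u≡ ⟨
  u                        ∎))
  where open ≤-Reasoning
... | inj₂ (u-even , _) | inj₁ (v-odd , _) | _ = zero , s≤s z≤n , v-odd , u-even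

y∸1≤ : ∀ {y m} → y ≤ m + 1 → y ∸ 1 ≤ m
y∸1≤ {y} {m} y≤ = subst (y ∸ 1 ≤_) (m+n∸n≡m m 1) (∸-monoˡ-≤ 1 y≤)

-- Shifting to x ∸ 1 < y ∸ 1 ≤ 2 ^ n is what makes n + 1 bits, hence n + 1 colours, enough.
separatingBitIndex : ℕ → Pair → ℕ
separatingBitIndex n (x , y) = least (separates? (x ∸ 1) (y ∸ 1)) n

separatingBitIndex< : ∀ n p → separatingBitIndex n p < n + 1
separatingBitIndex< n (x , y) = ≤-<-trans (least≤ (separates? (x ∸ 1) (y ∸ 1)) n) (m<m+n n z<s)

colour : ∀ n → Pair → Fin (n + 1)
colour n p = fromℕ< (separatingBitIndex< n p)

colour-separates : ∀ {n x y} → ShiftVertex (2 ^ n + 1) (x , y) →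
                   Separates (x ∸ 1) (y ∸ 1) (toℕ (colour n (x , y)))
colour-separates {n} {x} {y} (1≤x , x<y , y≤N)
  with separatingBit (suc n) (∸-monoˡ-< x<y 1≤x)
                             (≤-<-trans (y∸1≤ y≤N) (^-monoʳ-< 2 (s≤s (s≤s z≤n)) (n<1+n n)))
... | i , i<1+n , separates =
  subst (Separates (x ∸ 1) (y ∸ 1)) (sym (toℕ-fromℕ< (separatingBitIndex< n (x , y))))
        (least-sound (separates? (x ∸ 1) (y ∸ 1)) n (≤-pred i<1+n) separates)

colour-differs : ∀ {n x y z} → ShiftVertex (2 ^ n + 1) (x , y) → ShiftVertex (2 ^ n + 1) (y , z) →
                 colour n (x , y) ≢ colour n (y , z)
colour-differs {n} {y = y} xy yz same with colour-separates {n} xy | colour-separates {n} yz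
... | (y-set , _) | (_ , y-unset) = y-unset (subst (λ i → T (bit i (y ∸ 1))) (cong toℕ same) y-set)

colour-proper : ∀ n → IsProperColouring (ShiftVertex (2 ^ n + 1)) (n + 1) (colour n)
colour-proper n (x , y) (.y , z) xy yz (inj₁ refl) = colour-differs {n} xy yz
colour-proper n (x , y) (y′ , .x) xy yx (inj₂ refl) = colour-differs {n} yx xy ∘ sym

colourable-mono : ∀ {P Q : Pair → Set} {k} → (∀ {p} → P p → Q p) → Colourable Q k → Colourable P k
colourable-mono P⊆Q (c , proper) = c , λ u v Pu Pv → proper u v (P⊆Q Pu) (P⊆Q Pv)

InW-uncolourable : ∀ n m → m < n + 1 → ¬ Colourable (InW n) m
InW-uncolourable n m m<n+1 (c , proper) = W-uncolourable n (toℕ ∘ c) proper′ below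
  where
  proper′ : ProperOnW n (toℕ ∘ c)
  proper′ ij jl = proper _ _ (W⇒InW ij) (W⇒InW jl) (inj₁ refl) ∘ toℕ-injective
  below : ∀ {i j} → W n i j → toℕ (c (i , j)) < n
  below _ = <-≤-trans (toℕ<n (c _)) (≤-pred (subst (m <_) (+-comm n 1) m<n+1))

theorem4 : (n : ℕ) → 2 ≤ n →
    ChromaticNumberIs (InW n) (n + 1) × ChromaticNumberIs (ShiftVertex (2 ^ n + 1)) (n + 1)
theorem4 n _ =
  (colourable-mono proj₁ V-colourable , InW-uncolourable n) ,
  (V-colourable , λ m m<n+1 → InW-uncolourable n m m<n+1 ∘ colourable-mono proj₁)
  where
  V-colourable : Colourable (ShiftVertex (2 ^ n + 1)) (n + 1)
  V-colourable = colour n , colour-proper n
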